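{- Let $N$ be a positive integer and let $P$ be a polyomino of minimum size among polyominoes which contain at least $N$ instances of the T tetromino. Then no row of $P$ other than its top row contains fewer than three cells of $P$.
   Context: Cells are the unit squares of the square lattice, indexed by integer coordinates $(x,y)$ with $y$ increasing upward; a row is the set of cells with a fixed $y$. A polyomino is a finite nonempty edge-connected set of cells; its size is its number of cells. The T tetromino is $\{(-1,0),(0,0),(1,0),(0,1)\}$ (three cells in a row with one cell above the middle); only this orientation is considered. An instance of a shape is a translate of it; an instance in $P$ is one contained in $P$. The top row of $P$ is the highest row containing cells of $P$. -}

module Defs where

open import Data.Nat using (ℕ; suc; _≤_)
open import Data.Integer as ℤ using (ℤ; _+_; _-_; +_; -[1+_]; _<_)
import Data.Integer.Properties as ℤP
open import Data.Product using (_×_; _,_; proj₁; proj₂; Σ; ∃; ∃-syntax)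
open import Data.Product.Properties using (≡-dec)
open import Data.Sum using (_⊎_)
open import Data.List using (List; []; _∷_; length; filter; head; last)
open import Data.List.Relation.Unary.All using (All)
open import Data.List.Relation.Unary.Unique.Propositional using (Unique)
open import Data.List.Relation.Binary.Subset.Propositional using (_⊆_)
open import Data.Maybe using (just)
open import Relation.Binary.PropositionalEquality using (_≡_)
open import Relation.Binary.Definitions using (DecidableEquality)
open import Relation.Nullary using (¬_)
open import Relation.Unary using (Decidable)

-- A cell of the square lattice: (x , y), y increasing upward.
Cell : Set
Cell = ℤ × ℤ

_≟ᶜ_ : DecidableEquality Cell
_≟ᶜ_ = ≡-dec ℤP._≟_ ℤP._≟_

open import Data.List.Membership.DecPropositional _≟ᶜ_ using (_∈_; _∈?_) public

-- Finite sets of cells are represented by duplicate-free lists.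
CellSet : Set
CellSet = List Cell

row : Cell → ℤ
row = proj₂

Adjacent : Cell → Cell → Set
Adjacent (x , y) (x' , y') =
  ((x' ≡ x + + 1) × (y' ≡ y)) ⊎ ((x ≡ x' + + 1) × (y' ≡ y)) ⊎
  ((y' ≡ y + + 1) × (x' ≡ x)) ⊎ ((y ≡ y' + + 1) × (x' ≡ x))

data Chain : List Cell → Set where
  []  : Chain []
  [_] : ∀ c → Chain (c ∷ [])
  _∷_ : ∀ {c d cs} → Adjacent c d → Chain (d ∷ cs) → Chain (c ∷ d ∷ cs)

record PathIn (P : CellSet) (a b : Cell) : Set where
  field
    cells : List Cell
    chain : Chain cells
    start : head cells ≡ just a
    end   : last cells ≡ just b
    inside : cells ⊆ P

EdgeConnected : CellSet → Set
EdgeConnected P = ∀ {a b} → a ∈ P → b ∈ P → PathIn P a b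

record Polyomino : Set where
  field
    cells     : CellSet
    unique    : Unique cells
    nonempty  : 1 ≤ length cells
    connected : EdgeConnected cells
open Polyomino public

size : Polyomino → ℕ
size P = length (cells P)

-- The T tetromino {(-1,0),(0,0),(1,0),(0,1)} (this orientation only).
T : List Cell
T = (-[1+ 0 ] , + 0) ∷ (+ 0 , + 0) ∷ (+ 1 , + 0) ∷ (+ 0 , + 1) ∷ []

translate : Cell → List Cell → List Cell
translate (a , b) = Data.List.map (λ { (x , y) → (x + a , y + b) })

InstanceIn : CellSet → Cell → Set
InstanceIn P t = All (_∈ P) (translate t T)

instanceIn? : (P : CellSet) → Decidable (InstanceIn P)
instanceIn? P t = Data.List.Relation.Unary.All.all? (_∈? P) (translate t T)

-- Number of instances of T in P.  An instance T + t is determined by its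
-- translation vector t, and T + t ⊆ P forces t = t + (0,0) ∈ P, so the
-- instances in P are counted by the cells t of P with T + t ⊆ P.
#T : CellSet → ℕ
#T P = length (filter (instanceIn? P) P)

rowCount : CellSet → ℤ → ℕ
rowCount P y = length (filter (λ c → row c ℤP.≟ y) P)

IsRowOf : CellSet → ℤ → Set
IsRowOf P y = ∃[ c ] (c ∈ P × row c ≡ y)

IsTopRow : CellSet → ℤ → Set
IsTopRow P y = IsRowOf P y × All (λ c → row c ℤ.≤ y) P

MinimalFor : ℕ → Polyomino → Set
MinimalFor N P = N ≤ #T (cells P) × (∀ (Q : Polyomino) → N ≤ #T (cells Q) → size P ≤ size Q)

{-# OPTIONS --safe #-}
module Submission where

-- Suppose a row y below the top row has at most two cells.  Move every row above y down
-- by one, merging row y + 1 into row y.  Adjacent cells go to adjacent or equal cells, so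
-- the image is again a polyomino.  Since some cell of row y has a cell directly above it
-- (follow a path from a higher row down to row y), two cells merge and the image is
-- strictly smaller.  No instance of T has its bar in row y, and every other instance lies
-- weakly below row y or strictly above it, so it is moved rigidly and injectively onto an
-- instance in the image.  This contradicts minimality.

-- Defs exports membership specialised to Cell; the generic _∈_ imported below unfolds to it.
open import Defs hiding (_∈_)
open import Data.Nat using (ℕ; _≤_; _<_)
open import Data.Integer using (ℤ)
open import Relation.Nullary using (¬_)

open import Data.Nat using (z≤n; s≤s)
import Data.Nat.Properties as ℕP
open import Data.Integer as ℤ using (+_; -[1+_]; _+_; pred) renaming (suc to sucℤ)
import Data.Integer.Properties as ℤP
open import Data.Bool using (if_then_else_)
open import Data.Product using (∃-syntax; _×_; _,_; proj₁; proj₂)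
open import Data.Sum using (_⊎_; inj₁; inj₂)
open import Data.List using (List; []; _∷_; length; map; filter; head; last; deduplicate)
open import Data.List.Relation.Unary.Any as Any using (here; there)
open import Data.List.Relation.Unary.All using ([]; _∷_; lookup)
open import Data.List.Relation.Unary.All.Properties.Core using (¬All⇒Any¬)
open import Data.List.Relation.Unary.AllPairs using ([]; _∷_)
open import Data.List.Relation.Unary.Unique.Propositional using (Unique)
import Data.List.Relation.Unary.Unique.Propositional.Properties as Unique
open import Data.List.Relation.Unary.Unique.DecPropositional.Properties using (deduplicate-!)
open import Data.List.Relation.Binary.Subset.Propositional using (_⊆_)
open import Data.List.Membership.Propositional using (_∈_; find)
open import Data.List.Membership.Propositional.Properties
  using (∈-map⁺; ∈-map⁻; ∈-filter⁺; ∈-filter⁻; ∈-deduplicate⁺; ∈-deduplicate⁻)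
open import Data.List.Properties using (length-map; filter-notAll)
open import Data.Maybe using (just)
open import Data.Empty using (⊥-elim)
open import Function using (id; _∘_)
open import Relation.Binary.Definitions using (DecidableEquality; tri<; tri≈; tri>)
open import Relation.Binary.PropositionalEquality
open import Relation.Nullary using (Dec; yes; no; does; ¬?)
open import Relation.Nullary.Decidable using (dec-true; dec-false)

module Removal {A : Set} (_≟_ : DecidableEquality A) where

  _≢?_ : (z d : A) → Dec (z ≢ d)
  z ≢? d = ¬? (z ≟ d)

  length-filter-≢-< : ∀ {d xs} → d ∈ xs → length (filter (_≢? d) xs) < length xs
  length-filter-≢-< {d} {xs} d∈xs =
    filter-notAll (_≢? d) xs (Any.map (λ d≡z z≢d → z≢d (sym d≡z)) d∈xs)

module _ {B : Set} (_≟_ : DecidableEquality B) where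

  open Removal _≟_

  injective-image-length-≤ : ∀ {A : Set} (f : A → B) {xs ys} → Unique xs →
    (∀ {a b} → a ∈ xs → b ∈ xs → f a ≡ f b → a ≡ b) →
    (∀ {a} → a ∈ xs → f a ∈ ys) → length xs ≤ length ys
  injective-image-length-≤ f {[]} _ _ _ = z≤n
  injective-image-length-≤ f {x ∷ xs} {ys} (x∉xs ∷ xs!) f-inj f-into = begin-strict
    length xs                      ≤⟨ injective-image-length-≤ f xs! f-inj-rest f-into-rest ⟩
    length (filter (_≢? f x) ys)   <⟨ length-filter-≢-< (f-into (here refl)) ⟩
    length ys                      ∎
    where
    open ℕP.≤-Reasoning
    f-inj-rest : ∀ {a b} → a ∈ xs → b ∈ xs → f a ≡ f b → a ≡ b
    f-inj-rest a∈ b∈ = f-inj (there a∈) (there b∈)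

    f-into-rest : ∀ {a} → a ∈ xs → f a ∈ filter (_≢? f x) ys
    f-into-rest a∈xs = ∈-filter⁺ (_≢? f x) (f-into (there a∈xs))
      (λ fa≡fx → lookup x∉xs a∈xs (f-inj (here refl) (there a∈xs) (sym fa≡fx)))

  unique-length-≤ : ∀ {xs ys : List B} → Unique xs → xs ⊆ ys → length xs ≤ length ys
  unique-length-≤ xs! xs⊆ys = injective-image-length-≤ id xs! (λ _ _ → id) xs⊆ys

module _ {A B : Set} (_≟ᴬ_ : DecidableEquality A) (_≟ᴮ_ : DecidableEquality B) where

  open Removal _≟ᴬ_

  deduplicate-map-< : ∀ (g : A → B) {c d xs} → c ∈ xs → d ∈ xs → c ≢ d → g c ≡ g d →
    length (deduplicate _≟ᴮ_ (map g xs)) < length xs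
  deduplicate-map-< g {c} {d} {xs} c∈xs d∈xs c≢d gc≡gd = begin-strict
    length (deduplicate _≟ᴮ_ (map g xs)) ≤⟨ unique-length-≤ _≟ᴮ_ (deduplicate-! _≟ᴮ_ _) image⊆ ⟩
    length (map g (filter (_≢? d) xs))   ≡⟨ length-map g (filter (_≢? d) xs) ⟩
    length (filter (_≢? d) xs)           <⟨ length-filter-≢-< d∈xs ⟩
    length xs                            ∎
    where
    open ℕP.≤-Reasoning
    image⊆ : deduplicate _≟ᴮ_ (map g xs) ⊆ map g (filter (_≢? d) xs)
    image⊆ z∈ with ∈-map⁻ g (∈-deduplicate⁻ _≟ᴮ_ (map g xs) z∈)
    ... | e , e∈xs , refl with e ≟ᴬ d
    ...   | yes refl = subst (_∈ map g (filter (_≢? d) xs)) gc≡gd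
                              (∈-map⁺ g (∈-filter⁺ (_≢? d) c∈xs c≢d))
    ...   | no e≢d  = ∈-map⁺ g (∈-filter⁺ (_≢? d) e∈xs e≢d)

NonExpanding : (Cell → Cell) → Set
NonExpanding g = ∀ {c d} → Adjacent c d → g c ≡ g d ⊎ Adjacent (g c) (g d)

imageCells : (Cell → Cell) → CellSet → CellSet
imageCells g P = deduplicate _≟ᶜ_ (map g P)

module _ (g : Cell → Cell) {P : CellSet} where

  ∈-imageCells⁺ : ∀ {c} → c ∈ P → g c ∈ imageCells g P
  ∈-imageCells⁺ c∈P = ∈-deduplicate⁺ _≟ᶜ_ (∈-map⁺ g c∈P)

  ∈-imageCells⁻ : ∀ {z} → z ∈ imageCells g P → ∃[ c ] (c ∈ P × z ≡ g c)
  ∈-imageCells⁻ z∈ = ∈-map⁻ g (∈-deduplicate⁻ _≟ᶜ_ (map g P) z∈)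

imageCells-nonempty : ∀ {g P} → 1 ≤ length P → 1 ≤ length (imageCells g P)
imageCells-nonempty {P = _ ∷ _} _ = s≤s z≤n

data Walk (Q : CellSet) : Cell → Cell → Set where
  stop : ∀ {a} → a ∈ Q → Walk Q a a
  step : ∀ {a b c} → a ∈ Q → Adjacent a b → Walk Q b c → Walk Q a c

walk⇒path : ∀ {Q a b} → Walk Q a b → PathIn Q a b
walk⇒path {a = a} (stop a∈Q) = record
  { cells = a ∷ [] ; chain = [ a ] ; start = refl ; end = refl
  ; inside = λ { (here refl) → a∈Q ; (there ()) } }
walk⇒path {a = a} (step a∈Q a~b w) with walk⇒path w
... | record { cells = [] ; start = () }
... | record { cells = b ∷ cs ; chain = chain ; start = refl ; end = end ; inside = inside } = record
  { cells = a ∷ b ∷ cs ; chain = a~b ∷ chain ; start = refl ; end = end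
  ; inside = λ { (here refl) → a∈Q ; (there c∈) → inside c∈ } }

module _ {g : Cell → Cell} (g-nonExpanding : NonExpanding g) {P : CellSet} where

  chain⇒image-walk : ∀ {cs a b} → Chain cs → cs ⊆ P → head cs ≡ just a → last cs ≡ just b →
    Walk (imageCells g P) (g a) (g b)
  chain⇒image-walk [] _ () _
  chain⇒image-walk [ c ] cs⊆P refl refl = stop (∈-imageCells⁺ g (cs⊆P (here refl)))
  chain⇒image-walk {b = b} (c~d ∷ chain) cs⊆P refl end
    with g-nonExpanding c~d | chain⇒image-walk chain (cs⊆P ∘ there) refl end
  ... | inj₁ gc≡gd  | rest = subst (λ z → Walk (imageCells g P) z (g b)) (sym gc≡gd) rest
  ... | inj₂ gc~gd | rest = step (∈-imageCells⁺ g (cs⊆P (here refl))) gc~gd rest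

  imageCells-connected : EdgeConnected P → EdgeConnected (imageCells g P)
  imageCells-connected P-connected a∈ b∈
    with a , a∈P , refl ← ∈-imageCells⁻ g a∈ | b , b∈P , refl ← ∈-imageCells⁻ g b∈ =
    let open PathIn (P-connected a∈P b∈P) in walk⇒path (chain⇒image-walk chain inside start end)

image : (g : Cell → Cell) → NonExpanding g → Polyomino → Polyomino
image g g-nonExpanding P = record
  { cells     = imageCells g (cells P)
  ; unique    = deduplicate-! _≟ᶜ_ (map g (cells P))
  ; nonempty  = imageCells-nonempty {g} {cells P} (nonempty P)
  ; connected = imageCells-connected g-nonExpanding (connected P)
  }

image-size-< : ∀ {g} (g-nonExpanding : NonExpanding g) (P : Polyomino) {c d} →
  c ∈ cells P → d ∈ cells P → c ≢ d → g c ≡ g d → size (image g g-nonExpanding P) < size P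
image-size-< {g} _ P = deduplicate-map-< _≟ᶜ_ _≟ᶜ_ g {xs = cells P}

i+1≡suc[i] : ∀ i → i + + 1 ≡ sucℤ i
i+1≡suc[i] i = ℤP.+-comm i (+ 1)

pred[i+1]≡i : ∀ i → pred (i + + 1) ≡ i
pred[i+1]≡i i = trans (cong pred (i+1≡suc[i] i)) (ℤP.pred-suc i)

module _ {i j : ℤ} where

  <+1⇒≤ : i ℤ.< j + + 1 → i ℤ.≤ j
  <+1⇒≤ i<j+1 = subst (i ℤ.≤_) (pred[i+1]≡i j) (ℤP.i<j⇒i≤pred[j] i<j+1)

  <⇒+1≤ : i ℤ.< j → i + + 1 ℤ.≤ j
  <⇒+1≤ i<j = subst (ℤ._≤ j) (sym (i+1≡suc[i] i)) (ℤP.i<j⇒suc[i]≤j i<j)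

i<i+1 : ∀ i → i ℤ.< i + + 1
i<i+1 i = ℤP.suc[i]≤j⇒i<j (ℤP.≤-reflexive (sym (i+1≡suc[i] i)))

adjacent-descent : ∀ {y p q} → Adjacent p q → y ℤ.< row p → row q ℤ.≤ y →
  ∃[ x ] (p ≡ (x , y + + 1) × q ≡ (x , y))
adjacent-descent (inj₁ (_ , refl)) y<p q≤y = ⊥-elim (ℤP.<⇒≱ y<p q≤y)
adjacent-descent (inj₂ (inj₁ (_ , refl))) y<p q≤y = ⊥-elim (ℤP.<⇒≱ y<p q≤y)
adjacent-descent {p = _ , b} (inj₂ (inj₂ (inj₁ (refl , refl)))) y<p q≤y =
  ⊥-elim (ℤP.<⇒≱ y<p (ℤP.≤-trans (ℤP.i≤i+j b (+ 1)) q≤y))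
adjacent-descent {p = x , _} (inj₂ (inj₂ (inj₂ (refl , refl)))) y<p q≤y
  with refl ← ℤP.≤-antisym q≤y (<+1⇒≤ y<p) = x , refl , refl

chain-descent : ∀ {y a b cs} → Chain cs → head cs ≡ just a → last cs ≡ just b →
  y ℤ.< row a → row b ℤ.≤ y → ∃[ x ] ((x , y + + 1) ∈ cs × (x , y) ∈ cs)
chain-descent [] () _ _ _
chain-descent [ c ] refl refl y<c c≤y = ⊥-elim (ℤP.<⇒≱ y<c c≤y)
chain-descent {y} (_∷_ {d = d} c~d chain) refl end y<c b≤y with row d ℤP.≤? y
... | yes d≤y with x , refl , refl ← adjacent-descent c~d y<c d≤y = x , here refl , there (here refl)
... | no d≰y with x , up , down ← chain-descent chain refl end (ℤP.≰⇒> d≰y) b≤y =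
  x , there up , there down

non-top-row⇒cell-above : ∀ {P y} → EdgeConnected P → IsRowOf P y → ¬ IsTopRow P y →
  ∃[ x ] ((x , y + + 1) ∈ P × (x , y) ∈ P)
non-top-row⇒cell-above {P} {y} P-connected isRow@(r , r∈P , refl) notTop =
  let u , u∈P , u≰y = find (¬All⇒Any¬ (λ c → row c ℤP.≤? y) P (notTop ∘ (isRow ,_)))
      open PathIn (P-connected u∈P r∈P)
      x , up , down = chain-descent chain start end (ℤP.≰⇒> u≰y) ℤP.≤-refl
  in x , inside up , inside down

instance⇒3≤rowCount : ∀ {P t} → InstanceIn P t → 3 ≤ rowCount P (row t)
instance⇒3≤rowCount {P} {a , b} (left ∷ middle ∷ right ∷ _ ∷ []) =
  unique-length-≤ _≟ᶜ_ bar-unique bar⊆row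
  where
  bar : List Cell
  bar = (-[1+ 0 ] + a , + 0 + b) ∷ (+ 0 + a , + 0 + b) ∷ (+ 1 + a , + 0 + b) ∷ []

  distinct : ∀ {i j} → i ℤ.< j → (i + a , + 0 + b) ≢ (j + a , + 0 + b)
  distinct i<j eq = ℤP.<⇒≢ (ℤP.+-monoˡ-< a i<j) (cong proj₁ eq)

  bar-unique : Unique bar
  bar-unique = (distinct ℤ.-<+ ∷ distinct ℤ.-<+ ∷ [])
             ∷ (distinct (ℤ.+<+ (s≤s z≤n)) ∷ [])
             ∷ []
             ∷ []

  bar⊆row : bar ⊆ filter (λ c → row c ℤP.≟ b) P
  bar⊆row (here refl)                 = ∈-filter⁺ (λ c → row c ℤP.≟ b) left (ℤP.+-identityˡ b)
  bar⊆row (there (here refl))         = ∈-filter⁺ (λ c → row c ℤP.≟ b) middle (ℤP.+-identityˡ b)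
  bar⊆row (there (there (here refl))) = ∈-filter⁺ (λ c → row c ℤP.≟ b) right (ℤP.+-identityˡ b)

module Squash (y : ℤ) where

  lower : ℤ → ℤ
  lower b = if does (b ℤP.≤? y) then b else pred b

  squash : Cell → Cell
  squash (x , b) = x , lower b

  lower-≤ : ∀ {b} → b ℤ.≤ y → lower b ≡ b
  lower-≤ {b} b≤y rewrite dec-true (b ℤP.≤? y) b≤y = refl

  lower-> : ∀ {b} → y ℤ.< b → lower b ≡ pred b
  lower-> {b} y<b rewrite dec-false (b ℤP.≤? y) (ℤP.<⇒≱ y<b) = refl

  lower-y+1 : lower (y + + 1) ≡ lower y
  lower-y+1 = begin
    lower (y + + 1) ≡⟨ lower-> (i<i+1 y) ⟩
    pred (y + + 1)  ≡⟨ pred[i+1]≡i y ⟩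
    y               ≡⟨ lower-≤ ℤP.≤-refl ⟨
    lower y         ∎
    where open ≡-Reasoning

  lower-+1 : ∀ b → lower (b + + 1) ≡ lower b ⊎ lower (b + + 1) ≡ lower b + + 1
  lower-+1 b with ℤP.<-cmp b y
  ... | tri< b<y _ _  = inj₂ (begin
    lower (b + + 1) ≡⟨ lower-≤ (<⇒+1≤ b<y) ⟩
    b + + 1         ≡⟨ cong (_+ + 1) (lower-≤ (ℤP.<⇒≤ b<y)) ⟨
    lower b + + 1   ∎)
    where open ≡-Reasoning
  ... | tri≈ _ refl _ = inj₁ lower-y+1
  ... | tri> _ _ y<b  = inj₂ (begin
    lower (b + + 1) ≡⟨ lower-> (ℤP.<-≤-trans y<b (ℤP.i≤i+j b (+ 1))) ⟩
    pred (b + + 1)  ≡⟨ pred[i+1]≡i b ⟩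
    b               ≡⟨ ℤP.suc-pred b ⟨
    sucℤ (pred b)   ≡⟨ i+1≡suc[i] (pred b) ⟨
    pred b + + 1    ≡⟨ cong (_+ + 1) (lower-> y<b) ⟨
    lower b + + 1   ∎)
    where open ≡-Reasoning

  squash-nonExpanding : NonExpanding squash
  squash-nonExpanding (inj₁ (x≡ , refl))        = inj₂ (inj₁ (x≡ , refl))
  squash-nonExpanding (inj₂ (inj₁ (x≡ , refl))) = inj₂ (inj₂ (inj₁ (x≡ , refl)))
  squash-nonExpanding {x , b} (inj₂ (inj₂ (inj₁ (refl , refl)))) with lower-+1 b
  ... | inj₁ eq = inj₁ (cong (x ,_) (sym eq))
  ... | inj₂ eq = inj₂ (inj₂ (inj₂ (inj₁ (eq , refl))))
  squash-nonExpanding {d = x , b} (inj₂ (inj₂ (inj₂ (refl , refl)))) with lower-+1 b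
  ... | inj₁ eq = inj₁ (cong (x ,_) eq)
  ... | inj₂ eq = inj₂ (inj₂ (inj₂ (inj₂ (eq , refl))))

  squash-merges : ∀ x → squash (x , y + + 1) ≡ squash (x , y)
  squash-merges x = cong (x ,_) lower-y+1

  lower-straddle : ∀ {a b} → a ℤ.< y → y ℤ.< b → lower a ℤ.< lower b
  lower-straddle a<y y<b = subst₂ ℤ._<_ (sym (lower-≤ (ℤP.<⇒≤ a<y))) (sym (lower-> y<b))
                                   (ℤP.<-≤-trans a<y (ℤP.i<j⇒i≤pred[j] y<b))

  lower-injective : ∀ {a b} → a ≢ y → b ≢ y → lower a ≡ lower b → a ≡ b
  lower-injective {a} {b} a≢y b≢y eq with ℤP.<-cmp a y | ℤP.<-cmp b y
  ... | tri≈ _ a≡y _ | _            = ⊥-elim (a≢y a≡y)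
  ... | _            | tri≈ _ b≡y _ = ⊥-elim (b≢y b≡y)
  ... | tri< a<y _ _ | tri< b<y _ _ =
    trans (sym (lower-≤ (ℤP.<⇒≤ a<y))) (trans eq (lower-≤ (ℤP.<⇒≤ b<y)))
  ... | tri< a<y _ _ | tri> _ _ y<b = ⊥-elim (ℤP.<⇒≢ (lower-straddle a<y y<b) eq)
  ... | tri> _ _ y<a | tri< b<y _ _ = ⊥-elim (ℤP.<⇒≢ (lower-straddle b<y y<a) (sym eq))
  ... | tri> _ _ y<a | tri> _ _ y<b = begin
    a             ≡⟨ ℤP.suc-pred a ⟨
    sucℤ (pred a) ≡⟨ cong sucℤ (trans (sym (lower-> y<a)) (trans eq (lower-> y<b))) ⟩
    sucℤ (pred b) ≡⟨ ℤP.suc-pred b ⟩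
    b             ∎
    where open ≡-Reasoning

  lower-+ : ∀ {b} l → b ≢ y → l ≤ 1 → lower (+ l + b) ≡ + l + lower b
  lower-+ {b} l b≢y l≤1 with ℤP.<-cmp b y
  ... | tri< b<y _ _ = begin
    lower (+ l + b) ≡⟨ lower-≤ (ℤP.≤-trans (ℤP.+-monoˡ-≤ b (ℤ.+≤+ l≤1)) (ℤP.i<j⇒suc[i]≤j b<y)) ⟩
    + l + b         ≡⟨ cong (_+_ (+ l)) (lower-≤ (ℤP.<⇒≤ b<y)) ⟨
    + l + lower b   ∎
    where open ≡-Reasoning
  ... | tri≈ _ b≡y _ = ⊥-elim (b≢y b≡y)
  ... | tri> _ _ y<b = begin
    lower (+ l + b) ≡⟨ lower-> (ℤP.<-≤-trans y<b (ℤP.i≤j+i b (+ l))) ⟩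
    pred (+ l + b)  ≡⟨ ℤP.+-pred (+ l) b ⟨
    + l + pred b    ≡⟨ cong (_+_ (+ l)) (lower-> y<b) ⟨
    + l + lower b   ∎
    where open ≡-Reasoning

  squash-instance : ∀ {P Q t} → row t ≢ y → (∀ {c} → c ∈ P → squash c ∈ Q) →
    InstanceIn P t → InstanceIn Q (squash t)
  squash-instance {P} {Q} {a , b} b≢y squash-into (left ∷ middle ∷ right ∷ top ∷ []) =
    move 0 z≤n left ∷ move 0 z≤n middle ∷ move 0 z≤n right ∷ move 1 (s≤s z≤n) top ∷ []
    where
    move : ∀ {x} l → l ≤ 1 → (x , + l + b) ∈ P → (x , + l + lower b) ∈ Q
    move {x} l l≤1 c∈P = subst (λ r → (x , r) ∈ Q) (lower-+ l b≢y l≤1) (squash-into c∈P)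

  squash-#T-≤ : ∀ {P} → Unique P → ¬ 3 ≤ rowCount P y → #T P ≤ #T (imageCells squash P)
  squash-#T-≤ {P} P-unique sparse =
    injective-image-length-≤ _≟ᶜ_ squash (Unique.filter⁺ (instanceIn? P) P-unique)
      squash-injective squash-into
    where
    Q : CellSet
    Q = imageCells squash P

    anchors : CellSet
    anchors = filter (instanceIn? P) P

    anchor-row≢y : ∀ {t} → t ∈ anchors → row t ≢ y
    anchor-row≢y {t} t∈ row≡y = sparse (subst (λ r → 3 ≤ rowCount P r) row≡y
      (instance⇒3≤rowCount {P} {t} (proj₂ (∈-filter⁻ (instanceIn? P) {xs = P} t∈))))

    squash-injective : ∀ {s t} → s ∈ anchors → t ∈ anchors → squash s ≡ squash t → s ≡ t
    squash-injective s∈ t∈ eq =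
      cong₂ _,_ (cong proj₁ eq)
                (lower-injective (anchor-row≢y s∈) (anchor-row≢y t∈) (cong proj₂ eq))

    squash-into : ∀ {t} → t ∈ anchors → squash t ∈ filter (instanceIn? Q) Q
    squash-into {t} t∈ =
      let t∈P , instance-t = ∈-filter⁻ (instanceIn? P) {xs = P} t∈
      in ∈-filter⁺ (instanceIn? Q) (∈-imageCells⁺ squash t∈P)
           (squash-instance {P} {Q} {t} (anchor-row≢y t∈) (∈-imageCells⁺ squash) instance-t)

lemma5p2 : (N : ℕ) → 1 ≤ N → (P : Polyomino) → MinimalFor N P →
    (y : ℤ) → IsRowOf (cells P) y → ¬ IsTopRow (cells P) y →
    3 ≤ rowCount (cells P) y
lemma5p2 _ _ P (N≤#T , minimal) y isRow notTop with 3 ℕP.≤? rowCount (cells P) y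
... | yes dense = dense
... | no sparse with x , above , on-row ← non-top-row⇒cell-above (connected P) isRow notTop =
  ⊥-elim (ℕP.<⇒≱ smaller (minimal squashed (ℕP.≤-trans N≤#T (squash-#T-≤ (unique P) sparse))))
  where
  open Squash y

  squashed : Polyomino
  squashed = image squash squash-nonExpanding P

  smaller : size squashed < size P
  smaller = image-size-< squash-nonExpanding P above on-row
              (λ eq → ℤP.<⇒≢ (i<i+1 y) (sym (cong proj₂ eq))) (squash-merges x)
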